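{- Let $\ell\ge 3$ and let $C_{n,\ell}(x)$ denote the independence polynomial of the uniform linear hypercomb $C_{n,\ell}$ for $n\ge 1$, and set $C_{0,\ell}(x)=1+\ell x$. Then $$C_{1,\ell}(x)=1+(3\ell-2)x+\bigl(2(\ell-1)(\ell-2)+(\ell-1)^2+2(\ell-1)\bigr)x^2+(\ell-1)^2(\ell-2)x^3,$$ and for all $n\ge 2$, $$C_{n,\ell}(x)=(1+(\ell-1)x)\bigl((1+(\ell-2)x)C_{n-1,\ell}(x)+xC_{n-2,\ell}(x)\bigr).$$
   Context: A (strong) independent set in a hypergraph is a set of vertices containing at most one vertex from each edge; the independence polynomial of a hypergraph is $\sum_{k\ge0} i_k x^k$ where $i_k$ is the number of independent sets of size $k$. For $n\ge1$, $\ell\ge2$, $P_{n,\ell}$ is the linear hyperpath with edges $e_1,\ldots,e_n$ each of size $\ell$, with $e_i\cap e_{i+1}$ a single vertex for $i<n$ and no other pairs of edges intersecting. The uniform linear hypercomb $C_{n,\ell}$ ($n\ge1$) is obtained from $P_{n,\ell}$ by adding: for each vertex $v$ lying in two edges of $P_{n,\ell}$, a new edge of size $\ell$ consisting of $v$ and $\ell-1$ new vertices; and, for one vertex $w$ of $e_1$ lying in no other edge and one vertex $w'$ of $e_n$ lying in no other edge (with $w\ne w'$, enforced when $n=1$), a new edge of size $\ell$ consisting of $w$ and $\ell-1$ new vertices and a new edge of size $\ell$ consisting of $w'$ and $\ell-1$ new vertices. All new vertices are distinct from each other and from those of $P_{n,\ell}$. -}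

module Defs where

open import Data.Nat using (ℕ; zero; suc; _+_; _*_; _∸_; _≡ᵇ_; _≤ᵇ_)
open import Data.Bool using (Bool; true; false; _∧_; _∨_)
open import Data.List using (List; []; _∷_; map; upTo; length; filter; _++_)
open import Data.Bool using (T?)

-- Finite hypergraphs with vertices labelled by natural numbers.
-- V is the (duplicate-free) list of vertices, E the list of edges.

record Hypergraph : Set where
  constructor hypergraph
  field
    V : List ℕ
    E : List (List ℕ)

open Hypergraph public

-- all sublists (= all subsets, when the list is duplicate-free)
subsets : List ℕ → List (List ℕ)
subsets []       = [] ∷ []
subsets (x ∷ xs) = let r = subsets xs in r ++ map (x ∷_) r

anyᵇ : {A : Set} → (A → Bool) → List A → Bool
anyᵇ p []       = false
anyᵇ p (x ∷ xs) = p x ∨ anyᵇ p xs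

allᵇ : {A : Set} → (A → Bool) → List A → Bool
allᵇ p []       = true
allᵇ p (x ∷ xs) = p x ∧ allᵇ p xs

_∈ᵇ_ : ℕ → List ℕ → Bool
x ∈ᵇ S = anyᵇ (λ y → y ≡ᵇ x) S

-- strong independence: at most one vertex of S in every edge
isIndependent : Hypergraph → List ℕ → Bool
isIndependent H S = allᵇ (λ e → length (filter (λ v → T? (v ∈ᵇ S)) e) ≤ᵇ 1) (E H)

-- polynomials with natural coefficients, as coefficient sequences
Poly : Set
Poly = ℕ → ℕ

indPoly : Hypergraph → Poly
indPoly H k =
  length (filter (λ S → T? ((length S ≡ᵇ k) ∧ isIndependent H S)) (subsets (V H)))

_⊕_ : Poly → Poly → Poly
(p ⊕ q) k = p k + q k

X* : Poly → Poly
X* p zero    = 0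
X* p (suc k) = p k

lin* : ℕ → ℕ → Poly → Poly
lin* a b p k = a * p k + b * X* p k

fromCoeffs : List ℕ → Poly
fromCoeffs []       k       = 0
fromCoeffs (c ∷ cs) zero    = c
fromCoeffs (c ∷ cs) (suc k) = fromCoeffs cs k

-- Path P_{n,ℓ}: edge e_i (i = 0..n-1) = {i(ℓ-1), …, i(ℓ-1)+(ℓ-1)};
-- consecutive edges share exactly the vertex (i+1)(ℓ-1).
-- Teeth: at each vertex j(ℓ-1), j = 0..n, a new edge consisting of that
-- vertex and ℓ-1 fresh vertices.  For j = 1..n-1 these are the vertices
-- in two path edges; j = 0 gives w ∈ e_1 and j = n gives w' ∈ e_n.

range : ℕ → ℕ → List ℕ
range a len = map (a +_) (upTo len)

combPathSize : ℕ → ℕ → ℕ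
combPathSize n ℓ = n * (ℓ ∸ 1) + 1

combEdge : ℕ → ℕ → ℕ → List ℕ
combEdge n ℓ i = range (i * (ℓ ∸ 1)) ℓ

combTooth : ℕ → ℕ → ℕ → List ℕ
combTooth n ℓ j = j * (ℓ ∸ 1) ∷ range (combPathSize n ℓ + j * (ℓ ∸ 1)) (ℓ ∸ 1)

hypercomb : ℕ → ℕ → Hypergraph
hypercomb n ℓ = hypergraph
  (upTo (combPathSize n ℓ + suc n * (ℓ ∸ 1)))
  (map (combEdge n ℓ) (upTo n) ++ map (combTooth n ℓ) (upTo (suc n)))

Cpoly : ℕ → ℕ → Poly
Cpoly ℓ zero    = fromCoeffs (1 ∷ ℓ ∷ [])
Cpoly ℓ (suc m) = indPoly (hypercomb (suc m) ℓ)

module Submission where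

-- Order the vertices of the comb so that every spine vertex is followed by
-- the leaves of its tooth and then by the inner vertices of the next edge,
-- and count independent sets by deletion-contraction along this order.  A
-- block of vertices of which at most one may be used contributes a factor
-- 1 + (size)x, so reading the comb from a spine vertex s gives a transfer
-- recursion in two states, all sets (φ) and sets avoiding s (β):
--   β_d = (1 + (ℓ-1)x)(φ_{d-1} + (ℓ-2)x β_{d-1}),   φ_d = β_d + x β_{d-1}.
-- Eliminating β gives the recurrence for C_{n,ℓ} = φ_n.

open import Defs
open import Algebra.Properties.CommutativeSemigroup using (interchange)
open import Data.Bool using (Bool; true; false; not; _∧_; _∨_; T; T?; if_then_else_)
open import Data.Bool.Properties using (T-≡; ∧-assoc; ∧-zeroʳ; ∨-assoc; ∨-comm)
open import Data.Empty using (⊥-elim)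
open import Data.List using (List; []; _∷_; _++_; map; filter; length; upTo; applyUpTo)
open import Data.List.Membership.Propositional using (_∈_; _∉_)
open import Data.List.Membership.Propositional.Properties using (∈-++⁺ˡ; ∈-++⁺ʳ)
open import Data.List.Properties
  using (++-assoc; ++-identityʳ; filter-++; filter-none; length-++; length-map; length-upTo;
         map-++; map-∘; map-cong; map-id; map-upTo; upTo-∷ʳ)
open import Data.List.Relation.Binary.Permutation.Propositional
  using (_↭_; refl; prep; swap; trans; ↭-reflexive; ↭-trans; ↭⇒↭ₛ; module PermutationReasoning)
open import Data.List.Relation.Binary.Permutation.Propositional.Properties using (++⁺ˡ; shifts)
open import Data.List.Relation.Binary.Subset.Propositional using (_⊆_)
open import Data.List.Relation.Binary.Subset.Propositional.Properties
  using (∷⁺ʳ; xs⊆x∷xs; xs⊆xs++ys; xs⊆ys++xs; ++⁺ʳ)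
open import Data.List.Relation.Unary.All using (universal)
open import Data.List.Relation.Unary.AllPairs using (_∷_)
open import Data.List.Relation.Unary.Any using (here; there)
open import Data.List.Relation.Unary.Unique.Propositional using (Unique)
open import Data.List.Relation.Unary.Unique.Propositional.Properties using (upTo⁺; Unique[x∷xs]⇒x∉xs)
open import Data.Nat using (ℕ; zero; suc; _+_; _*_; _∸_; _≤_; s≤s; _≡ᵇ_; _≤ᵇ_)
open import Data.Nat.Properties
  using (≡ᵇ⇒≡; ≡⇒≡ᵇ; +-suc; +-identityʳ; +-comm; +-assoc; *-zeroʳ; *-identityˡ; *-identityʳ; +-commutativeSemigroup)
open import Data.Nat.Tactic.RingSolver using (solve-∀)
open import Data.Product using (_×_; _,_; proj₁; proj₂)
open import Function using (_∘_; Equivalence)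
open import Relation.Binary.Bundles using (Setoid)
open import Relation.Binary.PropositionalEquality
  using (_≡_; _≢_; _≗_; refl; sym; cong; cong₂; subst; module ≡-Reasoning; _→-setoid_; setoid)
  renaming (trans to ≡-trans)
open import Data.List.Relation.Binary.Permutation.Setoid.Properties (setoid ℕ) using (Unique-resp-↭)
import Relation.Binary.Reasoning.Setoid

range-suc : ∀ b m → range b (suc m) ≡ b ∷ range (suc b) m
range-suc b m = cong₂ _∷_ (+-identityʳ b) (begin
  map (b +_) (applyUpTo suc m)   ≡⟨ cong (map (b +_)) (map-upTo suc m) ⟨
  map (b +_) (map suc (upTo m))  ≡⟨ map-∘ (upTo m) ⟨
  map (λ i → b + suc i) (upTo m) ≡⟨ map-cong (+-suc b) (upTo m) ⟩
  range (suc b) m                ∎)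
  where open ≡-Reasoning

range-++ : ∀ b m k → range b (m + k) ≡ range b m ++ range (b + m) k
range-++ b zero    k = cong (λ z → range z k) (sym (+-identityʳ b))
range-++ b (suc m) k = begin
  range b (suc (m + k))                      ≡⟨ range-suc b (m + k) ⟩
  b ∷ range (suc b) (m + k)                  ≡⟨ cong (b ∷_) (range-++ (suc b) m k) ⟩
  b ∷ range (suc b) m ++ range (suc b + m) k ≡⟨ cong₂ (λ xs z → xs ++ range z k) (range-suc b m) (+-suc b m) ⟨
  range b (suc m) ++ range (b + suc m) k     ∎
  where open ≡-Reasoning

range-∷ʳ : ∀ b m → range b (suc m) ≡ range b m ++ b + m ∷ []
range-∷ʳ b m = ≡-trans (cong (map (b +_)) (sym (upTo-∷ʳ m))) (map-++ (b +_) (upTo m) (m ∷ []))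

length-range : ∀ b m → length (range b m) ≡ m
length-range b m = ≡-trans (length-map (b +_) (upTo m)) (length-upTo m)

upTo≡range : ∀ m → upTo m ≡ range 0 m
upTo≡range m = sym (map-id (upTo m))

module ≗-Reasoning = Relation.Binary.Reasoning.Setoid (ℕ →-setoid ℕ)
open Setoid (ℕ →-setoid ℕ) using () renaming (trans to ≗-trans)

⊕-cong : ∀ {p p′ q q′} → p ≗ p′ → q ≗ q′ → p ⊕ q ≗ p′ ⊕ q′
⊕-cong p≗p′ q≗q′ k = cong₂ _+_ (p≗p′ k) (q≗q′ k)

X*-cong : ∀ {p q} → p ≗ q → X* p ≗ X* q
X*-cong p≗q zero    = refl
X*-cong p≗q (suc k) = p≗q k

lin*-cong : ∀ a b {p q} → p ≗ q → lin* a b p ≗ lin* a b q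
lin*-cong a b p≗q k = cong₂ (λ u v → a * u + b * v) (p≗q k) (X*-cong p≗q k)

X*-lin* : ∀ a b p → X* (lin* a b p) ≗ lin* a b (X* p)
X*-lin* a b p zero    = sym (cong₂ _+_ (*-zeroʳ a) (*-zeroʳ b))
X*-lin* a b p (suc k) = refl

X*-⊕ : ∀ p q → X* (p ⊕ q) ≗ X* p ⊕ X* q
X*-⊕ p q zero    = refl
X*-⊕ p q (suc k) = refl

lin*-⊕ : ∀ a b p q → lin* a b (p ⊕ q) ≗ lin* a b p ⊕ lin* a b q
lin*-⊕ a b p q k =
  ≡-trans (cong (λ z → a * (p k + q k) + b * z) (X*-⊕ p q k)) (distrib a b (p k) (q k) (X* p k) (X* q k))
  where distrib : ∀ a b x y u v → a * (x + y) + b * (u + v) ≡ (a * x + b * u) + (a * y + b * v)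
        distrib = solve-∀

lin*-1 : ∀ b p → p ⊕ lin* 0 b p ≗ lin* 1 b p
lin*-1 b p k = cong (_+ b * X* p k) (sym (*-identityˡ (p k)))

X*-null : ∀ {r} → (∀ k → r k ≡ 0) → ∀ k → X* r k ≡ 0
X*-null r≡0 zero    = refl
X*-null r≡0 (suc k) = r≡0 k

⊕-X*-null : ∀ p {r} → (∀ k → r k ≡ 0) → p ⊕ X* r ≗ p
⊕-X*-null p r≡0 k = ≡-trans (cong (p k +_) (X*-null r≡0 k)) (+-identityʳ (p k))

⊕-lin*-null : ∀ b p {r} → (∀ k → r k ≡ 0) → p ⊕ lin* 0 b r ≗ p
⊕-lin*-null b p r≡0 k = begin
  p k + b * X* _ k ≡⟨ cong (λ z → p k + b * z) (X*-null r≡0 k) ⟩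
  p k + b * 0      ≡⟨ cong (p k +_) (*-zeroʳ b) ⟩
  p k + 0          ≡⟨ +-identityʳ (p k) ⟩
  p k              ∎
  where open ≡-Reasoning

Marking : Set
Marking = ℕ → Bool

mark : ℕ → Marking → Marking
mark x μ v = (x ≡ᵇ v) ∨ μ v

-- Subsets S are seen through their indicators (_∈ᵇ S), so that
-- indPoly H is subsetPoly (V H) applied to the independence test.
subsetPoly : List ℕ → (Marking → Bool) → Poly
subsetPoly L q k = length (filter (λ S → T? ((length S ≡ᵇ k) ∧ q (_∈ᵇ S))) (subsets L))

marked : List ℕ → Marking → ℕ
marked e μ = length (filter (λ v → T? (μ v)) e)

Agree : List ℕ → Marking → Marking → Set
Agree M μ ν = ∀ {v} → v ∈ M → μ v ≡ ν v

DependsOnly : List ℕ → (Marking → Bool) → Set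
DependsOnly M q = ∀ {μ ν} → Agree M μ ν → q μ ≡ q ν

SupportedOn : List ℕ → Marking → Set
SupportedOn L μ = ∀ {v} → μ v ≡ true → v ∈ L

avoiding : ℕ → (Marking → Bool) → Marking → Bool
avoiding x q μ = not (μ x) ∧ q μ

Extensional : (Marking → Bool) → Set
Extensional q = ∀ {μ ν} → μ ≗ ν → q μ ≡ q ν

mark-self : ∀ x μ → mark x μ x ≡ true
mark-self x μ = cong (_∨ μ x) (Equivalence.to T-≡ (≡⇒≡ᵇ x x refl))

mark-other : ∀ {x v} μ → x ≢ v → mark x μ v ≡ μ v
mark-other {x} {v} μ x≢v with x ≡ᵇ v in eq
... | true  = ⊥-elim (x≢v (≡ᵇ⇒≡ x v (Equivalence.from T-≡ eq)))
... | false = refl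

mark-agree : ∀ {x M} μ → x ∉ M → Agree M (mark x μ) μ
mark-agree {x} μ x∉M v∈M = mark-other {x} μ (λ { refl → x∉M v∈M })

mark-cong : ∀ x {μ ν} → μ ≗ ν → mark x μ ≗ mark x ν
mark-cong x μ≗ν v = cong ((x ≡ᵇ v) ∨_) (μ≗ν v)

mark-comm : ∀ x y μ → mark x (mark y μ) ≗ mark y (mark x μ)
mark-comm x y μ v = begin
  (x ≡ᵇ v) ∨ ((y ≡ᵇ v) ∨ μ v) ≡⟨ ∨-assoc (x ≡ᵇ v) (y ≡ᵇ v) (μ v) ⟨
  ((x ≡ᵇ v) ∨ (y ≡ᵇ v)) ∨ μ v ≡⟨ cong (_∨ μ v) (∨-comm (x ≡ᵇ v) (y ≡ᵇ v)) ⟩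
  ((y ≡ᵇ v) ∨ (x ≡ᵇ v)) ∨ μ v ≡⟨ ∨-assoc (y ≡ᵇ v) (x ≡ᵇ v) (μ v) ⟩
  (y ≡ᵇ v) ∨ ((x ≡ᵇ v) ∨ μ v) ∎
  where open ≡-Reasoning

unmarked : ∀ {L μ x} → SupportedOn L μ → x ∉ L → μ x ≡ false
unmarked {μ = μ} {x} supp x∉L with μ x in eq
... | true  = ⊥-elim (x∉L (supp eq))
... | false = refl

supportedOn-mark : ∀ {L μ} x → SupportedOn L μ → SupportedOn (x ∷ L) (mark x μ)
supportedOn-mark x supp {v} marked-v with x ≡ᵇ v in eq
... | true  = here (sym (≡ᵇ⇒≡ x v (Equivalence.from T-≡ eq)))
... | false = there (supp marked-v)

marked-cong : ∀ e {μ ν} → Agree e μ ν → marked e μ ≡ marked e ν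
marked-cong []      agree = refl
marked-cong (v ∷ e) {μ} {ν} agree rewrite agree (here refl) with ν v
... | true  = cong suc (marked-cong e (agree ∘ there))
... | false = marked-cong e (agree ∘ there)

marked-unmarked-∷ : ∀ {x μ} e → μ x ≡ false → marked (x ∷ e) μ ≡ marked e μ
marked-unmarked-∷ e μx≡false rewrite μx≡false = refl

marked-mark-∷ : ∀ {x e} μ → x ∉ e → marked (x ∷ e) (mark x μ) ≡ suc (marked e μ)
marked-mark-∷ {x} {e} μ x∉e rewrite mark-self x μ = cong suc (marked-cong e (mark-agree μ x∉e))

allᵇ-++ : ∀ {A : Set} (p : A → Bool) xs ys → allᵇ p (xs ++ ys) ≡ allᵇ p xs ∧ allᵇ p ys
allᵇ-++ p []       ys = refl
allᵇ-++ p (x ∷ xs) ys = ≡-trans (cong (p x ∧_) (allᵇ-++ p xs ys)) (sym (∧-assoc (p x) (allᵇ p xs) (allᵇ p ys)))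

∧-rearrange : ∀ x y z w → (x ∧ y) ∧ (z ∧ w) ≡ z ∧ (x ∧ (y ∧ w))
∧-rearrange true  true  z w = refl
∧-rearrange true  false z w = sym (∧-zeroʳ z)
∧-rearrange false y     z w = sym (∧-zeroʳ z)

marked-singleton-≤1 : ∀ x μ → (marked (x ∷ []) μ ≤ᵇ 1) ≡ true
marked-singleton-≤1 x μ with μ x
... | true  = refl
... | false = refl

marked-singleton-<1 : ∀ x μ → (suc (marked (x ∷ []) μ) ≤ᵇ 1) ≡ not (μ x)
marked-singleton-<1 x μ with μ x
... | true  = refl
... | false = refl

marked-++ : ∀ e f μ → marked (e ++ f) μ ≡ marked e μ + marked f μ
marked-++ e f μ = ≡-trans (cong length (filter-++ (λ v → T? (μ v)) e f)) (length-++ (filter (λ v → T? (μ v)) e))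

dependsOnly-⊆ : ∀ {M N q} → M ⊆ N → DependsOnly M q → DependsOnly N q
dependsOnly-⊆ M⊆N dep agree = dep (agree ∘ M⊆N)

dependsOnly-∧ : ∀ {M p q} → DependsOnly M p → DependsOnly M q → DependsOnly M (λ μ → p μ ∧ q μ)
dependsOnly-∧ dep-p dep-q agree = cong₂ _∧_ (dep-p agree) (dep-q agree)

dependsOnly-mark : ∀ {x M q} → DependsOnly (x ∷ M) q → DependsOnly M (q ∘ mark x)
dependsOnly-mark {x} dep {μ} {ν} agree = dep λ
  { (here refl)  → ≡-trans (mark-self x μ) (sym (mark-self x ν))
  ; (there v∈M) → cong (_ ∨_) (agree v∈M) }

ignores : ∀ {M q x} → DependsOnly M q → x ∉ M → ∀ μ → q (mark x μ) ≡ q μ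
ignores dep x∉M μ = dep (mark-agree μ x∉M)

dependsOnly⇒extensional : ∀ {M q} → DependsOnly M q → Extensional q
dependsOnly⇒extensional dep μ≗ν = dep (λ {v} _ → μ≗ν v)

length-filter-map : ∀ {A : Set} (p : A → Bool) (f : A → A) xs →
  length (filter (λ y → T? (p y)) (map f xs)) ≡ length (filter (λ x → T? (p (f x))) xs)
length-filter-map p f []       = refl
length-filter-map p f (x ∷ xs) with p (f x)
... | true  = cong suc (length-filter-map p f xs)
... | false = length-filter-map p f xs

subsetPoly-∷ : ∀ x L q → subsetPoly (x ∷ L) q ≗ subsetPoly L q ⊕ X* (subsetPoly L (q ∘ mark x))
subsetPoly-∷ x L q k = begin
  length (filter P (subsets L ++ map (x ∷_) (subsets L)))
    ≡⟨ cong length (filter-++ P (subsets L) (map (x ∷_) (subsets L))) ⟩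
  length (filter P (subsets L) ++ filter P (map (x ∷_) (subsets L)))
    ≡⟨ length-++ (filter P (subsets L)) ⟩
  subsetPoly L q k + length (filter P (map (x ∷_) (subsets L)))
    ≡⟨ cong (subsetPoly L q k +_) (≡-trans (length-filter-map _ (x ∷_) (subsets L)) (withX k)) ⟩
  subsetPoly L q k + X* (subsetPoly L (q ∘ mark x)) k
    ∎
  where
  open ≡-Reasoning
  P = λ S → T? ((length S ≡ᵇ k) ∧ q (_∈ᵇ S))
  withX : ∀ k → length (filter (λ S → T? ((suc (length S) ≡ᵇ k) ∧ q (_∈ᵇ (x ∷ S)))) (subsets L))
                ≡ X* (subsetPoly L (q ∘ mark x)) k
  withX zero    = cong length (filter-none _ (universal (λ _ ()) (subsets L)))
  withX (suc k) = refl

subsetPoly-[] : ∀ q k → subsetPoly [] q k ≡ (if (0 ≡ᵇ k) ∧ q (λ _ → false) then 1 else 0)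
subsetPoly-[] q k with (0 ≡ᵇ k) ∧ q (λ _ → false)
... | true  = refl
... | false = refl

subsetPoly-cong : ∀ L {q q′} → (∀ {μ} → SupportedOn L μ → q μ ≡ q′ μ) → subsetPoly L q ≗ subsetPoly L q′
subsetPoly-cong [] {q} {q′} q≡q′ k = begin
  subsetPoly [] q k                             ≡⟨ subsetPoly-[] q k ⟩
  (if (0 ≡ᵇ k) ∧ q (λ _ → false) then 1 else 0)  ≡⟨ cong (λ b → if (0 ≡ᵇ k) ∧ b then 1 else 0) (q≡q′ (λ ())) ⟩
  (if (0 ≡ᵇ k) ∧ q′ (λ _ → false) then 1 else 0) ≡⟨ subsetPoly-[] q′ k ⟨
  subsetPoly [] q′ k                            ∎
  where open ≡-Reasoning
subsetPoly-cong (x ∷ L) {q} {q′} q≡q′ = begin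
  subsetPoly (x ∷ L) q                                  ≈⟨ subsetPoly-∷ x L q ⟩
  subsetPoly L q ⊕ X* (subsetPoly L (q ∘ mark x))
    ≈⟨ ⊕-cong (subsetPoly-cong L (λ supp → q≡q′ (there ∘ supp)))
              (X*-cong (subsetPoly-cong L (λ supp → q≡q′ (supportedOn-mark x supp)))) ⟩
  subsetPoly L q′ ⊕ X* (subsetPoly L (q′ ∘ mark x))     ≈⟨ subsetPoly-∷ x L q′ ⟨
  subsetPoly (x ∷ L) q′                                 ∎
  where open ≗-Reasoning

subsetPoly-false : ∀ L k → subsetPoly L (λ _ → false) k ≡ 0
subsetPoly-false L k =
  cong length (filter-none _ (universal (λ S → subst T (∧-zeroʳ (length S ≡ᵇ k))) (subsets L)))

subsetPoly-none : ∀ L {q} → (∀ {μ} → SupportedOn L μ → q μ ≡ false) → ∀ k → subsetPoly L q k ≡ 0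
subsetPoly-none L q≡false k = ≡-trans (subsetPoly-cong L q≡false k) (subsetPoly-false L k)

subsetPoly-[]-true : subsetPoly [] (λ _ → true) ≗ fromCoeffs (1 ∷ [])
subsetPoly-[]-true zero    = refl
subsetPoly-[]-true (suc k) = refl

subsetPoly-∷∷ : ∀ x y L q → subsetPoly (x ∷ y ∷ L) q ≗
  (subsetPoly L q ⊕ X* (subsetPoly L (q ∘ mark y))) ⊕
  (X* (subsetPoly L (q ∘ mark x)) ⊕ X* (X* (subsetPoly L (q ∘ mark x ∘ mark y))))
subsetPoly-∷∷ x y L q = begin
  subsetPoly (x ∷ y ∷ L) q
    ≈⟨ subsetPoly-∷ x (y ∷ L) q ⟩
  subsetPoly (y ∷ L) q ⊕ X* (subsetPoly (y ∷ L) (q ∘ mark x))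
    ≈⟨ ⊕-cong (subsetPoly-∷ y L q) (X*-cong (subsetPoly-∷ y L (q ∘ mark x))) ⟩
  (subsetPoly L q ⊕ X* (subsetPoly L (q ∘ mark y))) ⊕
    X* (subsetPoly L (q ∘ mark x) ⊕ X* (subsetPoly L (q ∘ mark x ∘ mark y)))
    ≈⟨ ⊕-cong (λ _ → refl) (X*-⊕ _ _) ⟩
  (subsetPoly L q ⊕ X* (subsetPoly L (q ∘ mark y))) ⊕
    (X* (subsetPoly L (q ∘ mark x)) ⊕ X* (X* (subsetPoly L (q ∘ mark x ∘ mark y))))
    ∎
  where open ≗-Reasoning

subsetPoly-↭ : ∀ {L L′} → L ↭ L′ → ∀ {q} → Extensional q → subsetPoly L q ≗ subsetPoly L′ q
subsetPoly-↭ refl          ext = λ _ → refl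
subsetPoly-↭ (trans p p′)  ext = λ k → ≡-trans (subsetPoly-↭ p ext k) (subsetPoly-↭ p′ ext k)
subsetPoly-↭ {x ∷ L} {_ ∷ L′} (prep x p) {q} ext = begin
  subsetPoly (x ∷ L) q                              ≈⟨ subsetPoly-∷ x L q ⟩
  subsetPoly L q ⊕ X* (subsetPoly L (q ∘ mark x))
    ≈⟨ ⊕-cong (subsetPoly-↭ p ext) (X*-cong (subsetPoly-↭ p (ext ∘ mark-cong x))) ⟩
  subsetPoly L′ q ⊕ X* (subsetPoly L′ (q ∘ mark x)) ≈⟨ subsetPoly-∷ x L′ q ⟨
  subsetPoly (x ∷ L′) q                             ∎
  where open ≗-Reasoning
subsetPoly-↭ {x ∷ y ∷ L} {_ ∷ _ ∷ L′} (swap x y p) {q} ext = begin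
  subsetPoly (x ∷ y ∷ L) q
    ≈⟨ subsetPoly-∷∷ x y L q ⟩
  (subsetPoly L q ⊕ X* (subsetPoly L (q ∘ mark y))) ⊕
    (X* (subsetPoly L (q ∘ mark x)) ⊕ X* (X* (subsetPoly L (q ∘ mark x ∘ mark y))))
    ≈⟨ ⊕-cong (⊕-cong (subsetPoly-↭ p ext) (X*-cong (subsetPoly-↭ p (ext ∘ mark-cong y))))
              (⊕-cong (X*-cong (subsetPoly-↭ p (ext ∘ mark-cong x)))
                      (X*-cong (X*-cong (λ k → ≡-trans (subsetPoly-↭ p (ext ∘ mark-cong x ∘ mark-cong y) k)
                                                        (subsetPoly-cong L′ (λ {μ} _ → ext (mark-comm x y μ)) k))))) ⟩
  (subsetPoly L′ q ⊕ X* (subsetPoly L′ (q ∘ mark y))) ⊕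
    (X* (subsetPoly L′ (q ∘ mark x)) ⊕ X* (X* (subsetPoly L′ (q ∘ mark y ∘ mark x))))
    ≈⟨ (λ k → interchange +-commutativeSemigroup (F q k) (X* (F (q ∘ mark y)) k) (X* (F (q ∘ mark x)) k)
                              (X* (X* (F (q ∘ mark y ∘ mark x))) k)) ⟩
  (subsetPoly L′ q ⊕ X* (subsetPoly L′ (q ∘ mark x))) ⊕
    (X* (subsetPoly L′ (q ∘ mark y)) ⊕ X* (X* (subsetPoly L′ (q ∘ mark y ∘ mark x))))
    ≈⟨ subsetPoly-∷∷ y x L′ q ⟨
  subsetPoly (y ∷ x ∷ L′) q
    ∎
  where
  open ≗-Reasoning
  F : (Marking → Bool) → Poly
  F = subsetPoly L′

-- q m is the constraint that remains once m vertices of the block B are used.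
subsetPoly-block : ∀ B L (q : ℕ → Marking → Bool) → Unique (B ++ L) →
  (∀ {x} → x ∈ B → ∀ m μ → q m (mark x μ) ≡ q m μ) →
  (∀ m μ → q (2 + m) μ ≡ false) →
  subsetPoly (B ++ L) (λ μ → q (marked B μ) μ) ≗
    subsetPoly L (q 0) ⊕ lin* 0 (length B) (subsetPoly L (q 1))
subsetPoly-block []      L q u ignored excess k = sym (+-identityʳ _)
subsetPoly-block (x ∷ B) L q u@(_ ∷ u′) ignored excess = begin
  subsetPoly (x ∷ B ++ L) (λ μ → q (marked (x ∷ B) μ) μ)
    ≈⟨ subsetPoly-∷ x (B ++ L) (λ μ → q (marked (x ∷ B) μ) μ) ⟩
  subsetPoly (B ++ L) (λ μ → q (marked (x ∷ B) μ) μ) ⊕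
    X* (subsetPoly (B ++ L) (λ μ → q (marked (x ∷ B) (mark x μ)) (mark x μ)))
    ≈⟨ ⊕-cong (subsetPoly-cong (B ++ L) x-unmarked) (X*-cong (subsetPoly-cong (B ++ L) x-marked)) ⟩
  subsetPoly (B ++ L) (λ μ → q (marked B μ) μ) ⊕
    X* (subsetPoly (B ++ L) (λ μ → q (suc (marked B μ)) μ))
    ≈⟨ ⊕-cong (subsetPoly-block B L q u′ (ignored ∘ there) excess)
              (X*-cong (subsetPoly-block B L (q ∘ suc) u′ (λ x∈B m → ignored (there x∈B) (suc m)) (excess ∘ suc))) ⟩
  (subsetPoly L (q 0) ⊕ lin* 0 (length B) (subsetPoly L (q 1))) ⊕
    X* (subsetPoly L (q 1) ⊕ lin* 0 (length B) (subsetPoly L (q 2)))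
    ≈⟨ ⊕-cong (λ _ → refl) (X*-cong (⊕-lin*-null (length B) _ (subsetPoly-none L (λ {μ} _ → excess 0 μ)))) ⟩
  (subsetPoly L (q 0) ⊕ lin* 0 (length B) (subsetPoly L (q 1))) ⊕ X* (subsetPoly L (q 1))
    ≈⟨ (λ k → shift (length B) (subsetPoly L (q 0) k) (X* (subsetPoly L (q 1)) k)) ⟩
  subsetPoly L (q 0) ⊕ lin* 0 (suc (length B)) (subsetPoly L (q 1))
    ∎
  where
  open ≗-Reasoning
  x∉B++L : x ∉ B ++ L
  x∉B++L = Unique[x∷xs]⇒x∉xs u
  x-unmarked : ∀ {μ} → SupportedOn (B ++ L) μ → q (marked (x ∷ B) μ) μ ≡ q (marked B μ) μ
  x-unmarked {μ} supp = cong (λ m → q m μ) (marked-unmarked-∷ B (unmarked supp x∉B++L))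
  x-marked : ∀ {μ} → SupportedOn (B ++ L) μ →
    q (marked (x ∷ B) (mark x μ)) (mark x μ) ≡ q (suc (marked B μ)) μ
  x-marked {μ} _ = ≡-trans (cong (λ m → q m (mark x μ)) (marked-mark-∷ μ (x∉B++L ∘ ∈-++⁺ˡ)))
                           (ignored (here refl) _ μ)
  shift : ∀ b p r → (p + b * r) + r ≡ p + suc b * r
  shift = solve-∀

module Transfer (c : ℕ) where

  a ℓ : ℕ
  a = suc c
  ℓ = suc a

  one : Poly
  one = fromCoeffs (1 ∷ [])

  -- τ d and σ d count the part of the comb after the tooth at s, with s
  -- unused resp. used.
  mutual
    φ β τ σ : ℕ → Poly
    φ d = β d ⊕ X* (σ d)
    β d = lin* 1 a (τ d)

    τ zero    = one
    τ (suc d) = φ d ⊕ lin* 0 c (β d)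

    σ zero    = one
    σ (suc d) = β d

  φ-recurrence : ∀ d → φ (suc (suc d)) ≗ lin* 1 a (lin* 1 c (φ (suc d)) ⊕ X* (φ d))
  φ-recurrence d = begin
    lin* 1 a (φ (suc d) ⊕ lin* 0 c (β (suc d))) ⊕ X* (lin* 1 a (φ d ⊕ lin* 0 c (β d)))
      ≈⟨ ⊕-cong (λ _ → refl) (X*-lin* 1 a (φ d ⊕ lin* 0 c (β d))) ⟩
    lin* 1 a (φ (suc d) ⊕ lin* 0 c (β (suc d))) ⊕ lin* 1 a (X* (φ d ⊕ lin* 0 c (β d)))
      ≈⟨ lin*-⊕ 1 a (φ (suc d) ⊕ lin* 0 c (β (suc d))) (X* (φ d ⊕ lin* 0 c (β d))) ⟨
    lin* 1 a ((φ (suc d) ⊕ lin* 0 c (β (suc d))) ⊕ X* (φ d ⊕ lin* 0 c (β d)))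
      ≈⟨ lin*-cong 1 a regroup ⟩
    lin* 1 a (lin* 1 c (φ (suc d)) ⊕ X* (φ d))
      ∎
    where
    open ≗-Reasoning
    regroup : (φ (suc d) ⊕ lin* 0 c (β (suc d))) ⊕ X* (φ d ⊕ lin* 0 c (β d)) ≗ lin* 1 c (φ (suc d)) ⊕ X* (φ d)
    regroup zero    = cong (λ z → z + c * 0 + 0) (sym (*-identityˡ (φ (suc d) 0)))
    -- φ (suc d) k unfolds to β (suc d) k + X* (β d) k.
    regroup (suc k) = eq c (φ (suc d) (suc k)) (β (suc d) k) (φ d k) (X* (β d) k)
      where eq : ∀ c f b g h → (f + c * b) + (g + c * h) ≡ (1 * f + c * (b + h)) + g
            eq = solve-∀

  β-zero : β 0 ≗ fromCoeffs (1 ∷ a ∷ [])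
  β-zero zero          = cong suc (*-zeroʳ a)
  β-zero (suc zero)    = *-identityʳ a
  β-zero (suc (suc k)) = *-zeroʳ a

  φ-zero : φ 0 ≗ fromCoeffs (1 ∷ ℓ ∷ [])
  φ-zero k = ≡-trans (⊕-cong {q = X* one} β-zero (λ _ → refl) k) (add-x k)
    where add-x : fromCoeffs (1 ∷ a ∷ []) ⊕ X* one ≗ fromCoeffs (1 ∷ ℓ ∷ [])
          add-x zero          = refl
          add-x (suc zero)    = +-comm a 1
          add-x (suc (suc k)) = refl

  φ-one : φ 1 ≗ fromCoeffs (1 ∷ c + 2 * ℓ ∷ 2 * a * c + a * a + 2 * a ∷ a * a * c ∷ [])
  φ-one k = ≡-trans (⊕-cong (lin*-cong 1 a (⊕-cong φ-zero (lin*-cong 0 c β-zero))) (X*-cong β-zero) k)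
                    (coefficient k)
    where
    coefficient : lin* 1 a (fromCoeffs (1 ∷ ℓ ∷ []) ⊕ lin* 0 c (fromCoeffs (1 ∷ a ∷ []))) ⊕ X* (fromCoeffs (1 ∷ a ∷ []))
                  ≗ fromCoeffs (1 ∷ c + 2 * ℓ ∷ 2 * a * c + a * a + 2 * a ∷ a * a * c ∷ [])
    coefficient 0 = eq c
      where eq : ∀ c → let a = suc c in 1 * (1 + c * 0) + a * 0 + 0 ≡ 1
            eq = solve-∀
    coefficient 1 = eq c
      where eq : ∀ c → let a = suc c; ℓ = suc a in 1 * (ℓ + c * 1) + a * (1 + c * 0) + 1 ≡ c + 2 * ℓ
            eq = solve-∀
    coefficient 2 = eq c
      where eq : ∀ c → let a = suc c; ℓ = suc a in
                   1 * (0 + c * a) + a * (ℓ + c * 1) + a ≡ 2 * a * c + a * a + 2 * a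
            eq = solve-∀
    coefficient 3 = eq c
      where eq : ∀ c → let a = suc c in 1 * (0 + c * 0) + a * (0 + c * a) + 0 ≡ a * a * c
            eq = solve-∀
    coefficient (suc (suc (suc (suc k)))) = eq c
      where eq : ∀ c → let a = suc c in 1 * (0 + c * 0) + a * (0 + c * 0) + 0 ≡ 0
            eq = solve-∀

unique-tail : ∀ {x : ℕ} {xs} → Unique (x ∷ xs) → Unique xs
unique-tail (_ ∷ u) = u

unique-++ʳ : ∀ {ys : List ℕ} xs → Unique (xs ++ ys) → Unique ys
unique-++ʳ []       u        = u
unique-++ʳ (x ∷ xs) (_ ∷ u) = unique-++ʳ xs u

unique-++-disjoint : ∀ {x : ℕ} {ys} xs → Unique (xs ++ ys) → x ∈ xs → x ∉ ys
unique-++-disjoint (x ∷ xs) u       (here refl) x∈ys = Unique[x∷xs]⇒x∉xs u (∈-++⁺ʳ xs x∈ys)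
unique-++-disjoint (_ ∷ xs) (_ ∷ u) (there x∈xs) = unique-++-disjoint xs u x∈xs

module Comb (n c : ℕ) where

  open Transfer c

  spine : ℕ → ℕ
  spine i = i * a

  leaves inner : ℕ → List ℕ
  leaves i = range (combPathSize n ℓ + i * a) a
  inner i  = range (suc (i * a)) c

  edge-shape : ∀ i → combEdge n ℓ i ≡ spine i ∷ inner i ++ spine (suc i) ∷ []
  edge-shape i = begin
    range (i * a) (suc a)                     ≡⟨ range-suc (i * a) a ⟩
    spine i ∷ range (suc (i * a)) (suc c)     ≡⟨ cong (spine i ∷_) (range-∷ʳ (suc (i * a)) c) ⟩
    spine i ∷ inner i ++ suc (i * a + c) ∷ [] ≡⟨ cong (λ z → spine i ∷ inner i ++ suc z ∷ []) (+-comm (i * a) c) ⟩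
    spine i ∷ inner i ++ spine (suc i) ∷ []   ∎
    where open ≡-Reasoning

  -- The vertices from spine i on, in deletion order, when d edges remain.
  mutual
    suffix : ℕ → ℕ → List ℕ
    suffix i d = spine i ∷ leaves i ++ after i d

    after : ℕ → ℕ → List ℕ
    after i zero    = []
    after i (suc d) = inner i ++ suffix (suc i) d

  atMostOne : List ℕ → Marking → Bool
  atMostOne e μ = marked e μ ≤ᵇ 1

  mutual
    suffixOK : ℕ → ℕ → Marking → Bool
    suffixOK i d μ = atMostOne (combTooth n ℓ i) μ ∧ afterOK i d μ

    afterOK : ℕ → ℕ → Marking → Bool
    afterOK i zero    μ = true
    afterOK i (suc d) μ = atMostOne (combEdge n ℓ i) μ ∧ suffixOK (suc i) d μ

  atMostOne-dependsOnly : ∀ e → DependsOnly e (atMostOne e)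
  atMostOne-dependsOnly e agree = cong (_≤ᵇ 1) (marked-cong e agree)

  mutual
    suffixOK-dependsOnly : ∀ i d → DependsOnly (suffix i d) (suffixOK i d)
    suffixOK-dependsOnly i d = dependsOnly-∧
      (dependsOnly-⊆ (∷⁺ʳ (spine i) (xs⊆xs++ys (leaves i) (after i d)))
                     (atMostOne-dependsOnly (combTooth n ℓ i)))
      (dependsOnly-⊆ (∷⁺ʳ (spine i) (xs⊆ys++xs (after i d) (leaves i)))
                     (afterOK-dependsOnly i d))

    afterOK-dependsOnly : ∀ i d → DependsOnly (spine i ∷ after i d) (afterOK i d)
    afterOK-dependsOnly i zero    _ = refl
    afterOK-dependsOnly i (suc d) = dependsOnly-∧
      (dependsOnly-⊆ edge⊆ (atMostOne-dependsOnly (combEdge n ℓ i)))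
      (dependsOnly-⊆ (xs⊆x∷xs _ (spine i) ∘ xs⊆ys++xs (suffix (suc i) d) (inner i))
                     (suffixOK-dependsOnly (suc i) d))
      where
      edge⊆ : combEdge n ℓ i ⊆ spine i ∷ after i (suc d)
      edge⊆ rewrite edge-shape i = ∷⁺ʳ (spine i) (++⁺ʳ (inner i) λ { (here refl) → here refl })

  module ToothStep {i d} (u : Unique (suffix i d)) where

    spine∉ : spine i ∉ leaves i ++ after i d
    spine∉ = Unique[x∷xs]⇒x∉xs u

    unique-rest : Unique (leaves i ++ after i d)
    unique-rest = unique-tail u

    leaf∉ : ∀ {x} → x ∈ leaves i → x ∉ spine i ∷ after i d
    leaf∉ x∈B (here refl) = spine∉ (∈-++⁺ˡ x∈B)
    leaf∉ x∈B (there x∈A) = unique-++-disjoint (leaves i) unique-rest x∈B x∈A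

    tooth-unmarked : subsetPoly (leaves i ++ after i d) (suffixOK i d) ≗
                     lin* 1 a (subsetPoly (after i d) (afterOK i d))
    tooth-unmarked = begin
      subsetPoly (leaves i ++ after i d) (suffixOK i d)
        ≈⟨ subsetPoly-cong (leaves i ++ after i d) (λ {μ} supp →
             cong (λ m → (m ≤ᵇ 1) ∧ afterOK i d μ) (marked-unmarked-∷ {μ = μ} (leaves i) (unmarked supp spine∉))) ⟩
      subsetPoly (leaves i ++ after i d) (λ μ → q (marked (leaves i) μ) μ)
        ≈⟨ subsetPoly-block (leaves i) (after i d) q unique-rest ignored (λ _ _ → refl) ⟩
      rest ⊕ lin* 0 (length (leaves i)) rest
        ≈⟨ (λ k → cong (λ b → rest k + b * X* rest k) (length-range _ a)) ⟩
      rest ⊕ lin* 0 a rest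
        ≈⟨ lin*-1 a rest ⟩
      lin* 1 a rest
        ∎
      where
      open ≗-Reasoning
      rest : Poly
      rest = subsetPoly (after i d) (afterOK i d)
      q : ℕ → Marking → Bool
      q m μ = (m ≤ᵇ 1) ∧ afterOK i d μ
      ignored : ∀ {x} → x ∈ leaves i → ∀ m μ → q m (mark x μ) ≡ q m μ
      ignored x∈B m μ = cong ((m ≤ᵇ 1) ∧_) (ignores (afterOK-dependsOnly i d) (leaf∉ x∈B) μ)

    tooth-marked : subsetPoly (leaves i ++ after i d) (suffixOK i d ∘ mark (spine i)) ≗
                   subsetPoly (after i d) (afterOK i d ∘ mark (spine i))
    tooth-marked = begin
      subsetPoly (leaves i ++ after i d) (suffixOK i d ∘ mark (spine i))
        ≈⟨ subsetPoly-cong (leaves i ++ after i d) (λ {μ} _ →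
             cong (λ m → (m ≤ᵇ 1) ∧ afterOK i d (mark (spine i) μ)) (marked-mark-∷ {e = leaves i} μ (spine∉ ∘ ∈-++⁺ˡ))) ⟩
      subsetPoly (leaves i ++ after i d) (λ μ → q (marked (leaves i) μ) μ)
        ≈⟨ subsetPoly-block (leaves i) (after i d) q unique-rest ignored (λ _ _ → refl) ⟩
      subsetPoly (after i d) (q 0) ⊕ lin* 0 (length (leaves i)) (subsetPoly (after i d) (q 1))
        ≈⟨ ⊕-lin*-null (length (leaves i)) _ (subsetPoly-false (after i d)) ⟩
      subsetPoly (after i d) (afterOK i d ∘ mark (spine i))
        ∎
      where
      open ≗-Reasoning
      q : ℕ → Marking → Bool
      q m μ = (suc m ≤ᵇ 1) ∧ afterOK i d (mark (spine i) μ)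
      ignored : ∀ {x} → x ∈ leaves i → ∀ m μ → q m (mark x μ) ≡ q m μ
      ignored x∈B m μ =
        cong ((suc m ≤ᵇ 1) ∧_) (ignores (dependsOnly-mark (afterOK-dependsOnly i d)) (leaf∉ x∈B ∘ there) μ)

    spine-split : subsetPoly (suffix i d) (suffixOK i d) ≗
      lin* 1 a (subsetPoly (after i d) (afterOK i d)) ⊕ X* (subsetPoly (after i d) (afterOK i d ∘ mark (spine i)))
    spine-split = begin
      subsetPoly (suffix i d) (suffixOK i d)
        ≈⟨ subsetPoly-∷ (spine i) (leaves i ++ after i d) (suffixOK i d) ⟩
      subsetPoly (leaves i ++ after i d) (suffixOK i d) ⊕
        X* (subsetPoly (leaves i ++ after i d) (suffixOK i d ∘ mark (spine i)))
        ≈⟨ ⊕-cong tooth-unmarked (X*-cong tooth-marked) ⟩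
      lin* 1 a (subsetPoly (after i d) (afterOK i d)) ⊕ X* (subsetPoly (after i d) (afterOK i d ∘ mark (spine i)))
        ∎
      where open ≗-Reasoning

    spine-split-avoiding : subsetPoly (suffix i d) (avoiding (spine i) (suffixOK i d)) ≗
                           lin* 1 a (subsetPoly (after i d) (afterOK i d))
    spine-split-avoiding = begin
      subsetPoly (suffix i d) (avoiding (spine i) (suffixOK i d))
        ≈⟨ subsetPoly-∷ (spine i) (leaves i ++ after i d) (avoiding (spine i) (suffixOK i d)) ⟩
      subsetPoly (leaves i ++ after i d) (avoiding (spine i) (suffixOK i d)) ⊕
        X* (subsetPoly (leaves i ++ after i d) (avoiding (spine i) (suffixOK i d) ∘ mark (spine i)))
        ≈⟨ ⊕-X*-null _ (subsetPoly-none (leaves i ++ after i d) (λ {μ} _ → cong (λ b → not b ∧ suffixOK i d (mark (spine i) μ)) (mark-self (spine i) μ))) ⟩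
      subsetPoly (leaves i ++ after i d) (avoiding (spine i) (suffixOK i d))
        ≈⟨ subsetPoly-cong (leaves i ++ after i d) (λ {μ} supp → cong (λ b → not b ∧ suffixOK i d μ) (unmarked {μ = μ} supp spine∉)) ⟩
      subsetPoly (leaves i ++ after i d) (suffixOK i d)
        ≈⟨ tooth-unmarked ⟩
      lin* 1 a (subsetPoly (after i d) (afterOK i d))
        ∎
      where open ≗-Reasoning

  module EdgeStep {i d} (u : Unique (suffix i (suc d))) where

    unique-after : Unique (inner i ++ suffix (suc i) d)
    unique-after = unique-++ʳ (leaves i) (unique-tail u)

    unique-next : Unique (suffix (suc i) d)
    unique-next = unique-++ʳ (inner i) unique-after

    spine∉ : spine i ∉ inner i ++ suffix (suc i) d
    spine∉ = Unique[x∷xs]⇒x∉xs u ∘ ∈-++⁺ʳ (leaves i)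

    inner∉ : ∀ {x} → x ∈ inner i → x ∉ suffix (suc i) d
    inner∉ = unique-++-disjoint (inner i) unique-after

    next-ignores : ∀ {x} → x ∉ suffix (suc i) d → ∀ μ →
      marked (spine (suc i) ∷ []) (mark x μ) ≡ marked (spine (suc i) ∷ []) μ ×
      suffixOK (suc i) d (mark x μ) ≡ suffixOK (suc i) d μ
    next-ignores {x} x∉ μ = marked-cong (spine (suc i) ∷ []) (mark-agree {x} μ λ { (here refl) → x∉ (here refl) })
                      , ignores (suffixOK-dependsOnly (suc i) d) x∉ μ

    marked-edge-unmarked : ∀ {μ} → μ (spine i) ≡ false →
      marked (combEdge n ℓ i) μ ≡ marked (inner i) μ + marked (spine (suc i) ∷ []) μ
    marked-edge-unmarked {μ} unmarked-s = begin
      marked (combEdge n ℓ i) μ                           ≡⟨ cong (λ e → marked e μ) (edge-shape i) ⟩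
      marked (spine i ∷ inner i ++ spine (suc i) ∷ []) μ ≡⟨ marked-unmarked-∷ (inner i ++ spine (suc i) ∷ []) unmarked-s ⟩
      marked (inner i ++ spine (suc i) ∷ []) μ           ≡⟨ marked-++ (inner i) (spine (suc i) ∷ []) μ ⟩
      marked (inner i) μ + marked (spine (suc i) ∷ []) μ  ∎
      where open ≡-Reasoning

    marked-edge-marked : ∀ μ →
      marked (combEdge n ℓ i) (mark (spine i) μ) ≡ suc (marked (inner i) μ + marked (spine (suc i) ∷ []) μ)
    marked-edge-marked μ = begin
      marked (combEdge n ℓ i) (mark (spine i) μ)
        ≡⟨ cong (λ e → marked e (mark (spine i) μ)) (edge-shape i) ⟩
      marked (spine i ∷ inner i ++ spine (suc i) ∷ []) (mark (spine i) μ)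
        ≡⟨ marked-mark-∷ μ (spine∉ ∘ ++⁺ʳ (inner i) λ { (here refl) → here refl }) ⟩
      suc (marked (inner i ++ spine (suc i) ∷ []) μ)
        ≡⟨ cong suc (marked-++ (inner i) (spine (suc i) ∷ []) μ) ⟩
      suc (marked (inner i) μ + marked (spine (suc i) ∷ []) μ)
        ∎
      where open ≡-Reasoning

    edge-unmarked : subsetPoly (after i (suc d)) (afterOK i (suc d)) ≗
      subsetPoly (suffix (suc i) d) (suffixOK (suc i) d) ⊕
        lin* 0 c (subsetPoly (suffix (suc i) d) (avoiding (spine (suc i)) (suffixOK (suc i) d)))
    edge-unmarked = begin
      subsetPoly (inner i ++ suffix (suc i) d) (afterOK i (suc d))
        ≈⟨ subsetPoly-cong (inner i ++ suffix (suc i) d) (λ {μ} supp →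
             cong (λ m → (m ≤ᵇ 1) ∧ suffixOK (suc i) d μ) (marked-edge-unmarked {μ} (unmarked {μ = μ} supp spine∉))) ⟩
      subsetPoly (inner i ++ suffix (suc i) d) (λ μ → q (marked (inner i) μ) μ)
        ≈⟨ subsetPoly-block (inner i) (suffix (suc i) d) q unique-after ignored (λ _ _ → refl) ⟩
      subsetPoly (suffix (suc i) d) (q 0) ⊕ lin* 0 (length (inner i)) (subsetPoly (suffix (suc i) d) (q 1))
        ≈⟨ ⊕-cong (subsetPoly-cong (suffix (suc i) d) (λ {μ} _ →
                     cong (_∧ suffixOK (suc i) d μ) (marked-singleton-≤1 (spine (suc i)) μ)))
                  (λ k → cong₂ _*_ (length-range _ c) (X*-cong (subsetPoly-cong (suffix (suc i) d) (λ {μ} _ →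
                     cong (_∧ suffixOK (suc i) d μ) (marked-singleton-<1 (spine (suc i)) μ))) k)) ⟩
      subsetPoly (suffix (suc i) d) (suffixOK (suc i) d) ⊕
        lin* 0 c (subsetPoly (suffix (suc i) d) (avoiding (spine (suc i)) (suffixOK (suc i) d)))
        ∎
      where
      open ≗-Reasoning
      q : ℕ → Marking → Bool
      q m μ = (m + marked (spine (suc i) ∷ []) μ ≤ᵇ 1) ∧ suffixOK (suc i) d μ
      ignored : ∀ {x} → x ∈ inner i → ∀ m μ → q m (mark x μ) ≡ q m μ
      ignored x∈I m μ with next-ignores (inner∉ x∈I) μ
      ... | same-s′ , same-rest = cong₂ (λ t b → (m + t ≤ᵇ 1) ∧ b) same-s′ same-rest

    edge-marked : subsetPoly (after i (suc d)) (afterOK i (suc d) ∘ mark (spine i)) ≗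
      subsetPoly (suffix (suc i) d) (avoiding (spine (suc i)) (suffixOK (suc i) d))
    edge-marked = begin
      subsetPoly (inner i ++ suffix (suc i) d) (afterOK i (suc d) ∘ mark (spine i))
        ≈⟨ subsetPoly-cong (inner i ++ suffix (suc i) d) (λ {μ} _ →
             cong₂ (λ m b → (m ≤ᵇ 1) ∧ b) (marked-edge-marked μ)
                   (ignores (suffixOK-dependsOnly (suc i) d) (spine∉ ∘ ∈-++⁺ʳ (inner i)) μ)) ⟩
      subsetPoly (inner i ++ suffix (suc i) d) (λ μ → q (marked (inner i) μ) μ)
        ≈⟨ subsetPoly-block (inner i) (suffix (suc i) d) q unique-after ignored (λ _ _ → refl) ⟩
      subsetPoly (suffix (suc i) d) (q 0) ⊕ lin* 0 (length (inner i)) (subsetPoly (suffix (suc i) d) (q 1))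
        ≈⟨ ⊕-lin*-null (length (inner i)) _ (subsetPoly-false (suffix (suc i) d)) ⟩
      subsetPoly (suffix (suc i) d) (q 0)
        ≈⟨ subsetPoly-cong (suffix (suc i) d) (λ {μ} _ →
             cong (_∧ suffixOK (suc i) d μ) (marked-singleton-<1 (spine (suc i)) μ)) ⟩
      subsetPoly (suffix (suc i) d) (avoiding (spine (suc i)) (suffixOK (suc i) d))
        ∎
      where
      open ≗-Reasoning
      q : ℕ → Marking → Bool
      q m μ = (suc (m + marked (spine (suc i) ∷ []) μ) ≤ᵇ 1) ∧ suffixOK (suc i) d μ
      ignored : ∀ {x} → x ∈ inner i → ∀ m μ → q m (mark x μ) ≡ q m μ
      ignored x∈I m μ with next-ignores (inner∉ x∈I) μ
      ... | same-s′ , same-rest = cong₂ (λ t b → (suc (m + t) ≤ᵇ 1) ∧ b) same-s′ same-rest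

  mutual
    suffix-poly : ∀ d i → Unique (suffix i d) →
      subsetPoly (suffix i d) (suffixOK i d) ≗ φ d ×
      subsetPoly (suffix i d) (avoiding (spine i) (suffixOK i d)) ≗ β d
    suffix-poly d i u =
        ≗-trans spine-split (⊕-cong (lin*-cong 1 a rest) (X*-cong rest-marked))
      , ≗-trans spine-split-avoiding (lin*-cong 1 a rest)
      where
      open ToothStep {i} {d} u
      rest        = proj₁ (after-poly d i u)
      rest-marked = proj₂ (after-poly d i u)

    after-poly : ∀ d i → Unique (suffix i d) →
      subsetPoly (after i d) (afterOK i d) ≗ τ d ×
      subsetPoly (after i d) (afterOK i d ∘ mark (spine i)) ≗ σ d
    after-poly zero    i u = subsetPoly-[]-true , subsetPoly-[]-true
    after-poly (suc d) i u =
        ≗-trans edge-unmarked (⊕-cong next (lin*-cong 0 c next-avoiding))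
      , ≗-trans edge-marked next-avoiding
      where
      open EdgeStep {i} {d} u
      next          = proj₁ (suffix-poly d (suc i) unique-next)
      next-avoiding = proj₂ (suffix-poly d (suc i) unique-next)

  path-range : ∀ j d → range (j * a) (suc d * a + 1) ≡ spine j ∷ inner j ++ range (suc j * a) (d * a + 1)
  path-range j d = begin
    range (j * a) (suc (c + d * a + 1))                   ≡⟨ range-suc (j * a) (c + d * a + 1) ⟩
    spine j ∷ range (suc (j * a)) (c + d * a + 1)         ≡⟨ cong (λ m → spine j ∷ range (suc (j * a)) m) (+-assoc c (d * a) 1) ⟩
    spine j ∷ range (suc (j * a)) (c + (d * a + 1))       ≡⟨ cong (spine j ∷_) (range-++ (suc (j * a)) c (d * a + 1)) ⟩
    spine j ∷ inner j ++ range (suc (j * a + c)) (d * a + 1)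
      ≡⟨ cong (λ z → spine j ∷ inner j ++ range (suc z) (d * a + 1)) (+-comm (j * a) c) ⟩
    spine j ∷ inner j ++ range (suc j * a) (d * a + 1)    ∎
    where open ≡-Reasoning

  teeth-range : ∀ j d → range (combPathSize n ℓ + j * a) (suc (suc d) * a) ≡
                        leaves j ++ range (combPathSize n ℓ + suc j * a) (suc d * a)
  teeth-range j d = ≡-trans (range-++ (P + j * a) a (suc d * a))
                            (cong (λ z → leaves j ++ range z (suc d * a)) (≡-trans (+-assoc P (j * a) a) (cong (P +_) (+-comm (j * a) a))))
    where P = combPathSize n ℓ

  suffix-↭ : ∀ d j → range (j * a) (d * a + 1) ++ range (combPathSize n ℓ + j * a) (suc d * a) ↭ suffix j d
  suffix-↭ zero j = ↭-reflexive (≡-trans (cong₂ _++_ (range-suc (j * a) 0) (cong (range _) (+-identityʳ a)))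
                                        (cong (spine j ∷_) (sym (++-identityʳ (leaves j)))))
  suffix-↭ (suc d) j = begin
    range (j * a) (suc d * a + 1) ++ range (combPathSize n ℓ + j * a) (suc (suc d) * a)
      ≡⟨ cong₂ _++_ (path-range j d) (teeth-range j d) ⟩
    spine j ∷ (inner j ++ X) ++ leaves j ++ Y
      ↭⟨ prep (spine j) regroup ⟩
    suffix j (suc d) ∎
    where
    open PermutationReasoning
    X = range (suc j * a) (d * a + 1)
    Y = range (combPathSize n ℓ + suc j * a) (suc d * a)
    regroup : (inner j ++ X) ++ leaves j ++ Y ↭ leaves j ++ inner j ++ suffix (suc j) d
    regroup = begin
      (inner j ++ X) ++ leaves j ++ Y  ≡⟨ ++-assoc (inner j) X (leaves j ++ Y) ⟩
      inner j ++ X ++ leaves j ++ Y    ↭⟨ ++⁺ˡ (inner j) (shifts X (leaves j)) ⟩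
      inner j ++ leaves j ++ X ++ Y    ↭⟨ shifts (inner j) (leaves j) ⟩
      leaves j ++ inner j ++ X ++ Y    ↭⟨ ++⁺ˡ (leaves j) (++⁺ˡ (inner j) (suffix-↭ d (suc j))) ⟩
      leaves j ++ inner j ++ suffix (suc j) d ∎

  vertices-↭ : V (hypercomb n ℓ) ↭ suffix 0 n
  vertices-↭ = ↭-trans (↭-reflexive vertex-ranges) (suffix-↭ n 0)
    where
    P = combPathSize n ℓ
    vertex-ranges : upTo (P + suc n * a) ≡ range 0 P ++ range (P + 0 * a) (suc n * a)
    vertex-ranges = ≡-trans (upTo≡range (P + suc n * a))
                   (≡-trans (range-++ 0 P (suc n * a)) (cong (λ z → range 0 P ++ range z (suc n * a)) (sym (+-identityʳ P))))

  allAtMostOne : List (List ℕ) → Marking → Bool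
  allAtMostOne es μ = allᵇ (λ e → atMostOne e μ) es

  edges-and-teeth : ∀ d j μ → allAtMostOne (map (combEdge n ℓ) (range j d)) μ ∧
                              allAtMostOne (map (combTooth n ℓ) (range j (suc d))) μ ≡ suffixOK j d μ
  edges-and-teeth zero    j μ = cong (λ js → allAtMostOne (map (combTooth n ℓ) js) μ) (range-suc j 0)
  edges-and-teeth (suc d) j μ = begin
    allAtMostOne (map (combEdge n ℓ) (range j (suc d))) μ ∧ allAtMostOne (map (combTooth n ℓ) (range j (suc (suc d)))) μ
      ≡⟨ cong₂ (λ js js′ → allAtMostOne (map (combEdge n ℓ) js) μ ∧ allAtMostOne (map (combTooth n ℓ) js′) μ)
               (range-suc j d) (range-suc j (suc d)) ⟩
    (atMostOne (combEdge n ℓ j) μ ∧ edges) ∧ (atMostOne (combTooth n ℓ j) μ ∧ teeth)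
      ≡⟨ ∧-rearrange (atMostOne (combEdge n ℓ j) μ) edges (atMostOne (combTooth n ℓ j) μ) teeth ⟩
    atMostOne (combTooth n ℓ j) μ ∧ (atMostOne (combEdge n ℓ j) μ ∧ (edges ∧ teeth))
      ≡⟨ cong (λ b → atMostOne (combTooth n ℓ j) μ ∧ (atMostOne (combEdge n ℓ j) μ ∧ b)) (edges-and-teeth d (suc j) μ) ⟩
    suffixOK j (suc d) μ ∎
    where
    open ≡-Reasoning
    edges = allAtMostOne (map (combEdge n ℓ) (range (suc j) d)) μ
    teeth = allAtMostOne (map (combTooth n ℓ) (range (suc j) (suc d))) μ

  independence-test : ∀ μ → allAtMostOne (E (hypercomb n ℓ)) μ ≡ suffixOK 0 n μ
  independence-test μ = begin
    allAtMostOne (map (combEdge n ℓ) (upTo n) ++ map (combTooth n ℓ) (upTo (suc n))) μ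
      ≡⟨ allᵇ-++ (λ e → atMostOne e μ) (map (combEdge n ℓ) (upTo n)) _ ⟩
    allAtMostOne (map (combEdge n ℓ) (upTo n)) μ ∧ allAtMostOne (map (combTooth n ℓ) (upTo (suc n))) μ
      ≡⟨ cong₂ (λ xs ys → allAtMostOne (map (combEdge n ℓ) xs) μ ∧ allAtMostOne (map (combTooth n ℓ) ys) μ)
               (upTo≡range n) (upTo≡range (suc n)) ⟩
    allAtMostOne (map (combEdge n ℓ) (range 0 n)) μ ∧ allAtMostOne (map (combTooth n ℓ) (range 0 (suc n))) μ
      ≡⟨ edges-and-teeth n 0 μ ⟩
    suffixOK 0 n μ ∎
    where open ≡-Reasoning

  indPoly-hypercomb : indPoly (hypercomb n ℓ) ≗ φ n
  indPoly-hypercomb = begin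
    subsetPoly (V (hypercomb n ℓ)) (allAtMostOne (E (hypercomb n ℓ)))
      ≈⟨ subsetPoly-cong (V (hypercomb n ℓ)) (λ {μ} _ → independence-test μ) ⟩
    subsetPoly (V (hypercomb n ℓ)) (suffixOK 0 n)
      ≈⟨ subsetPoly-↭ vertices-↭ (dependsOnly⇒extensional (suffixOK-dependsOnly 0 n)) ⟩
    subsetPoly (suffix 0 n) (suffixOK 0 n)
      ≈⟨ proj₁ (suffix-poly n 0 (Unique-resp-↭ (↭⇒↭ₛ vertices-↭) (upTo⁺ _))) ⟩
    φ n ∎
    where open ≗-Reasoning

Cpoly≗φ : ∀ c m → Cpoly (2 + c) m ≗ Transfer.φ c m
Cpoly≗φ c zero    k = sym (Transfer.φ-zero c k)
Cpoly≗φ c (suc m)   = Comb.indPoly-hypercomb (suc m) c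

-- Transfer.φ-one is this statement: for ℓ = 2 + c, 3 * ℓ ∸ 2 computes to
-- c + 2 * ℓ, ℓ ∸ 1 to a and ℓ ∸ 2 to c.
Cpoly-one : ∀ c → let ℓ = 2 + c in
  Cpoly ℓ 1 ≗ fromCoeffs (1 ∷ (3 * ℓ ∸ 2) ∷ (2 * (ℓ ∸ 1) * (ℓ ∸ 2) + (ℓ ∸ 1) * (ℓ ∸ 1) + 2 * (ℓ ∸ 1)) ∷
                          ((ℓ ∸ 1) * (ℓ ∸ 1) * (ℓ ∸ 2)) ∷ [])
Cpoly-one c = ≗-trans (Cpoly≗φ c 1) (Transfer.φ-one c)

Cpoly-recurrence : ∀ c d → let ℓ = 2 + c in
  Cpoly ℓ (2 + d) ≗ lin* 1 (ℓ ∸ 1) (lin* 1 (ℓ ∸ 2) (Cpoly ℓ (suc d)) ⊕ X* (Cpoly ℓ d))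
Cpoly-recurrence c d = begin
  Cpoly ℓ (2 + d)                                      ≈⟨ Cpoly≗φ c (2 + d) ⟩
  φ (2 + d)                                            ≈⟨ φ-recurrence d ⟩
  lin* 1 a (lin* 1 c (φ (suc d)) ⊕ X* (φ d))
    ≈⟨ lin*-cong 1 a (⊕-cong (lin*-cong 1 c (Cpoly≗φ c (suc d))) (X*-cong (Cpoly≗φ c d))) ⟨
  lin* 1 a (lin* 1 c (Cpoly ℓ (suc d)) ⊕ X* (Cpoly ℓ d)) ∎
  where
  open Transfer c
  open ≗-Reasoning

theorem1p3 : (ℓ : ℕ) → 3 ≤ ℓ →
      ((k : ℕ) → Cpoly ℓ 1 k ≡ fromCoeffs (1 ∷ (3 * ℓ ∸ 2) ∷ (2 * (ℓ ∸ 1) * (ℓ ∸ 2) + (ℓ ∸ 1) * (ℓ ∸ 1) + 2 * (ℓ ∸ 1)) ∷ ((ℓ ∸ 1) * (ℓ ∸ 1) * (ℓ ∸ 2)) ∷ []) k)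
    × ((n : ℕ) → 2 ≤ n → (k : ℕ) →
        Cpoly ℓ n k ≡ lin* 1 (ℓ ∸ 1) (lin* 1 (ℓ ∸ 2) (Cpoly ℓ (n ∸ 1)) ⊕ X* (Cpoly ℓ (n ∸ 2))) k)
theorem1p3 (suc (suc c)) (s≤s (s≤s (s≤s _))) = Cpoly-one c , λ where
  (suc zero)    (s≤s ())
  (suc (suc d)) _ → Cpoly-recurrence c d
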